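{- Let $\pi\in\mathfrak{B}_n$ and $1\le i,j\le n$. If $\langle i,j\rangle$ is a positive square of $P_\pi$ (i.e. $\pi_i=j$), then $d^+(i,j)=d^+(i+1,j+1)=(0,0)$ and $d^+(i,j+1)=d^+(i+1,j)=(1,1)$. If $\langle i,j\rangle$ is a negative square of $P_\pi$ (i.e. $\pi_i=-j$), then $d^-(i,j)=d^-(i+1,j+1)=(1,1)$ and $d^-(i,j+1)=d^-(i+1,j)=(0,0)$.
   Context: $\mathfrak{B}_n$ is the set of signed permutations $\pi=\pi_1\cdots\pi_n$ ($\pi_i\in\{\pm1,\dots,\pm n\}$, $|\pi_1|,\dots,|\pi_n|$ a permutation of $[n]$), $\pi_0=0$, inverse given by $\pi^{ -1}_{|\pi_i|}=\operatorname{sgn}(\pi_i)\,i$. Natural order: $\operatorname{des}^B(\pi)=|\{i\in\{0,\dots,n-1\}:\pi_i>\pi_{i+1}\}|$, $\operatorname{ides}^B(\pi)=\operatorname{des}^B(\pi^{ -1})$. The grid $P_\pi$ is an $n\times n$ array of squares, rows numbered from the top and columns from the left; square $\langle i,j\rangle$ is in row $i$, column $j$; the square $\langle i,|\pi_i|\rangle$ is a positive square if $\pi_i>0$ and a negative square if $\pi_i<0$. The grid point $(i,j)$, $1\le i,j\le n+1$, is the intersection of the $i$-th horizontal and $j$-th vertical grid lines, so $\langle i,j\rangle$ has corners $(i,j),(i,j+1),(i+1,j),(i+1,j+1)$. For $i,j\in[n+1]$, $\varphi_{(i,j)}(\pi)$ is the $\sigma\in\mathfrak{B}_{n+1}$ with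 $\sigma_i=j$, $\sigma_k=s(\pi_k)$ for $k<i$, $\sigma_k=s(\pi_{k-1})$ for $k>i$, where $s(x)=x$ if $|x|<j$, $s(x)=x+1$ if $x\ge j$, $s(x)=x-1$ if $x\le-j$; $\overline{\varphi}_{(i,j)}(\pi)$ is the same with $\sigma_i=-j$. $d^+(i,j)=\big(\operatorname{des}^B(\varphi_{(i,j)}(\pi))-\operatorname{des}^B(\pi),\ \operatorname{ides}^B(\varphi_{(i,j)}(\pi))-\operatorname{ides}^B(\pi)\big)$ and $d^-(i,j)$ is the same with $\overline{\varphi}_{(i,j)}$. -}

module Defs where

open import Data.Nat as ℕ using (ℕ; zero; suc)
open import Data.Integer as ℤ using (ℤ; +_; -_; ∣_∣)
open import Data.List using (List; []; _∷_; _++_; map; take; drop; upTo; length)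
open import Data.List.Relation.Binary.Permutation.Propositional using (_↭_)
open import Data.Bool using (Bool; true; false; if_then_else_)
open import Relation.Nullary.Decidable using (⌊_⌋)
open import Data.Product using (_×_; _,_)

-- A signed permutation of [n] is a list π₁ ⋯ πₙ of integers whose absolute
-- values form a permutation of 1,…,n (this also forces length n and πᵢ ≠ 0).
IsSignedPerm : ℕ → List ℤ → Set
IsSignedPerm n π = map ∣_∣ π ↭ map suc (upTo n)

-- πᵢ with the convention π₀ = 0 (positions are 1-based; out of range gives 0).
entry : List ℤ → ℕ → ℤ
entry π zero = + 0
entry [] (suc k) = + 0
entry (x ∷ π) (suc zero) = x
entry (x ∷ π) (suc (suc k)) = entry π (suc k)

desFrom : ℤ → List ℤ → ℕ
desFrom prev [] = 0
desFrom prev (x ∷ π) = (if ⌊ x ℤ.<? prev ⌋ then 1 else 0) ℕ.+ desFrom x π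

desB : List ℤ → ℕ
desB π = desFrom (+ 0) π

signedPos : ℕ → ℕ → List ℤ → ℤ
signedPos m i [] = + 0
signedPos m i (x ∷ π) =
  if ⌊ ∣ x ∣ ℕ.≟ m ⌋
  then (if ⌊ x ℤ.<? + 0 ⌋ then - (+ i) else + i)
  else signedPos m (suc i) π

-- inverse: π⁻¹_{|πᵢ|} = sgn(πᵢ)·i, i.e. (π⁻¹)_m = signedPos of m, m = 1..n
inverse : List ℤ → List ℤ
inverse π = map (λ m → signedPos (suc m) 1 π) (upTo (length π))

idesB : List ℤ → ℕ
idesB π = desB (inverse π)

shift : ℕ → ℤ → ℤ
shift j x =
  if ⌊ ∣ x ∣ ℕ.<? j ⌋ then x
  else (if ⌊ + 0 ℤ.≤? x ⌋ then x ℤ.+ + 1 else x ℤ.- + 1)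

insertAt : ℕ → ℕ → ℤ → List ℤ → List ℤ
insertAt i j v π = map (shift j) (take (i ℕ.∸ 1) π) ++ (v ∷ map (shift j) (drop (i ℕ.∸ 1) π))

φ : ℕ → ℕ → List ℤ → List ℤ
φ i j π = insertAt i j (+ j) π

φ̄ : ℕ → ℕ → List ℤ → List ℤ
φ̄ i j π = insertAt i j (- (+ j)) π

diff : ℕ → ℕ → ℤ
diff a b = + a ℤ.- + b

dPair : List ℤ → List ℤ → ℤ × ℤ
dPair σ π = diff (desB σ) (desB π) , diff (idesB σ) (idesB π)

d⁺ : List ℤ → ℕ → ℕ → ℤ × ℤ
d⁺ π i j = dPair (φ i j π) π

d⁻ : List ℤ → ℕ → ℕ → ℤ × ℤ
d⁻ π i j = dPair (φ̄ i j π) π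

-- Inserting, next to the pivot πᵢ = ±j, a value of the same sign and adjacent absolute value
-- creates a pair of entries that no other entry (nor π₀ = 0) separates in value, while the
-- shift s preserves the relative order of everything else. Hence every comparison of
-- consecutive entries survives except the one inside the new pair, and des^B grows by 1 or 0
-- according to whether that pair is a descent. Inversion transposes the grid: the inverse of
-- φ at (p, q) is φ at (q, p) applied to π⁻¹, whose pivot ±i sits at position j, so the same
-- count gives ides^B, with the corners (i, j+1) and (i+1, j) exchanged.

module Submission where

open import Defs
open import Data.Bool using (Bool; true; false; not; if_then_else_)
open import Data.Empty using (⊥-elim)
open import Data.Integer as ℤ using (ℤ; +_; -[1+_]; -_; ∣_∣)
import Data.Integer.Properties as ℤ
open import Data.List using (List; []; _∷_; _++_; map; take; drop; length; applyUpTo; upTo)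
import Data.List.Properties as List
open import Data.List.Relation.Unary.All as All using (All; []; _∷_)
import Data.List.Relation.Unary.All.Properties as All
open import Data.List.Relation.Unary.AllPairs using (AllPairs; _∷_)
import Data.List.Relation.Unary.AllPairs.Properties as AllPairs
import Data.List.Relation.Unary.Unique.Propositional.Properties as Unique
open import Data.List.Relation.Binary.Permutation.Propositional using (↭-sym; ↭⇒↭ₛ)
open import Data.List.Relation.Binary.Permutation.Propositional.Properties using (↭-length)
open import Data.Nat as ℕ using (ℕ; zero; suc; _+_; _≤_; _<_; z≤n; s≤s)
import Data.Nat.Properties as ℕ
open import Data.Product using (_×_; _,_)
open import Data.Sum using (_⊎_; inj₁; inj₂)
open import Function using (_∘_)
open import Function.Bundles using (_⇔_; mk⇔)
open import Relation.Nullary using (Dec; ¬_)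
open import Relation.Binary.Definitions using (tri<; tri≈; tri>)
open import Relation.Nullary.Decidable using (⌊_⌋; isYes≗does; dec-true; dec-false; does-⇔)
open import Relation.Binary.PropositionalEquality
open import Algebra.Properties.CommutativeSemigroup ℕ.+-commutativeSemigroup using (x∙yz≈y∙xz)
open import Data.List.Relation.Binary.Permutation.Setoid.Properties (setoid ℕ) using (Unique-resp-↭)

isYes-true : {A : Set} (a? : Dec A) → A → ⌊ a? ⌋ ≡ true
isYes-true a? a = trans (isYes≗does a?) (dec-true a? a)

isYes-false : {A : Set} (a? : Dec A) → ¬ A → ⌊ a? ⌋ ≡ false
isYes-false a? ¬a = trans (isYes≗does a?) (dec-false a? ¬a)

isYes-⇔ : {A B : Set} → A ⇔ B → (a? : Dec A) (b? : Dec B) → ⌊ a? ⌋ ≡ ⌊ b? ⌋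
isYes-⇔ A⇔B a? b? = trans (isYes≗does a?) (trans (does-⇔ A⇔B a? b?) (sym (isYes≗does b?)))

infix 5 _<ᵇ_

_<ᵇ_ : ℤ → ℤ → Bool
x <ᵇ y = ⌊ x ℤ.<? y ⌋

bit : Bool → ℕ
bit b = if b then 1 else 0

signed : Bool → ℕ → ℤ
signed b m = if b then - (+ m) else + m

∣signed∣ : ∀ b m → ∣ signed b m ∣ ≡ m
∣signed∣ true  m = ℤ.∣-i∣≡∣i∣ (+ m)
∣signed∣ false m = refl

signed-suc-≢0 : ∀ b m → signed b (suc m) ≢ + 0
signed-suc-≢0 true  m ()
signed-suc-≢0 false m ()

signed-suc-<ᵇ0 : ∀ b m → signed b (suc m) <ᵇ + 0 ≡ b
signed-suc-<ᵇ0 true  m = refl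
signed-suc-<ᵇ0 false m = refl

signed-suc-<ᵇ : ∀ b m → signed b (suc (suc m)) <ᵇ signed b (suc m) ≡ b
signed-suc-<ᵇ true  m = isYes-true (-[1+ suc m ] ℤ.<? -[1+ m ]) (ℤ.-<- (ℕ.n<1+n m))
signed-suc-<ᵇ false m =
  isYes-false (+ suc (suc m) ℤ.<? + suc m) (λ { (ℤ.+<+ h) → ℕ.<-asym h (ℕ.n<1+n (suc m)) })

signed-<ᵇ-suc : ∀ b m → signed b (suc m) <ᵇ signed b (suc (suc m)) ≡ not b
signed-<ᵇ-suc true  m =
  isYes-false (-[1+ m ] ℤ.<? -[1+ suc m ]) (λ { (ℤ.-<- h) → ℕ.<-asym h (ℕ.n<1+n m) })
signed-<ᵇ-suc false m = isYes-true (+ suc m ℤ.<? + suc (suc m)) (ℤ.+<+ (ℕ.n<1+n (suc m)))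

mono⇒<ᵇ-invariant : (f : ℤ → ℤ) → (∀ {x y} → x ℤ.< y → f x ℤ.< f y) →
  ∀ x y → f x <ᵇ f y ≡ x <ᵇ y
mono⇒<ᵇ-invariant f mono x y = isYes-⇔ (mk⇔ reflect mono) (f x ℤ.<? f y) (x ℤ.<? y)
  where
  reflect : f x ℤ.< f y → x ℤ.< y
  reflect fx<fy with ℤ.<-cmp x y
  ... | tri< x<y _ _ = x<y
  ... | tri≈ _ refl _ = ⊥-elim (ℤ.<-irrefl refl fx<fy)
  ... | tri> _ _ y<x = ⊥-elim (ℤ.<-asym fx<fy (mono y<x))

-- The shift s

shift-< : ∀ {q} x → ∣ x ∣ < q → shift q x ≡ x
shift-< {q} x h rewrite isYes-true (∣ x ∣ ℕ.<? q) h = refl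

shift-+ : ∀ {q} a → q ≤ a → shift q (+ a) ≡ + suc a
shift-+ {q} a h rewrite isYes-false (a ℕ.<? q) (ℕ.≤⇒≯ h) = cong +_ (ℕ.+-comm a 1)

shift-- : ∀ {q} a → q ≤ suc a → shift q -[1+ a ] ≡ -[1+ suc a ]
shift-- {q} a h rewrite isYes-false (suc a ℕ.<? q) (ℕ.≤⇒≯ h) = cong (λ z → -[1+ suc z ]) (ℕ.+-identityʳ a)

shift-zero : ∀ {q} → 1 ≤ q → shift q (+ 0) ≡ + 0
shift-zero = shift-< (+ 0)

∣shift∣-≥ : ∀ {q} x → q ≤ ∣ x ∣ → ∣ shift q x ∣ ≡ suc ∣ x ∣
∣shift∣-≥ (+ a)    h rewrite shift-+ a h = refl
∣shift∣-≥ -[1+ a ] h rewrite shift-- a h = refl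

shift-signed : ∀ {p} b c → 1 ≤ p → p ≤ c → shift p (signed b c) ≡ signed b (suc c)
shift-signed false c       _   p≤c = shift-+ c p≤c
shift-signed true  (suc c) _   p≤c = shift-- c p≤c
shift-signed true  zero    1≤p p≤0 = ⊥-elim (ℕ.<-irrefl refl (ℕ.<-≤-trans 1≤p p≤0))

shift-signed-< : ∀ {p} b c → c < p → shift p (signed b c) ≡ signed b c
shift-signed-< b c c<p = shift-< (signed b c) (subst (_< _) (sym (∣signed∣ b c)) c<p)

shift-mono : ∀ q {x y} → x ℤ.< y → shift q x ℤ.< shift q y
shift-mono q {x} {y} x<y with ℕ.<-≤-connex ∣ x ∣ q | ℕ.<-≤-connex ∣ y ∣ q
shift-mono q {x} {y} x<y | inj₁ x<q | inj₁ y<q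
  rewrite shift-< x x<q | shift-< y y<q = x<y
shift-mono q {x} {+ b} x<y | inj₁ x<q | inj₂ q≤b
  rewrite shift-< x x<q | shift-+ b q≤b = ℤ.<-trans x<y (ℤ.+<+ (ℕ.n<1+n b))
shift-mono q { -[1+ c ] } { -[1+ b ] } (ℤ.-<- b<c) | inj₁ c<q | inj₂ q≤b =
  ⊥-elim (ℕ.<-irrefl refl (ℕ.<-≤-trans c<q (ℕ.≤-trans q≤b (ℕ.m≤n⇒m≤1+n b<c))))
shift-mono q {+ a} {+ b} (ℤ.+<+ a<b) | inj₂ q≤a | inj₁ b<q =
  ⊥-elim (ℕ.<-irrefl refl (ℕ.<-≤-trans b<q (ℕ.≤-trans q≤a (ℕ.<⇒≤ a<b))))
shift-mono q { -[1+ a ] } {y} x<y | inj₂ q≤a | inj₁ y<q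
  rewrite shift-- a q≤a | shift-< y y<q = ℤ.<-trans (ℤ.-<- (ℕ.n<1+n a)) x<y
shift-mono q {+ a} {+ b} (ℤ.+<+ a<b) | inj₂ q≤a | inj₂ q≤b
  rewrite shift-+ a q≤a | shift-+ b q≤b = ℤ.+<+ (s≤s a<b)
shift-mono q { -[1+ a ] } {+ b} _ | inj₂ q≤a | inj₂ q≤b
  rewrite shift-- a q≤a | shift-+ b q≤b = ℤ.-<+
shift-mono q { -[1+ a ] } { -[1+ b ] } (ℤ.-<- b<a) | inj₂ q≤a | inj₂ q≤b
  rewrite shift-- a q≤a | shift-- b q≤b = ℤ.-<- (s≤s b<a)

shift-<ᵇ : ∀ q x y → shift q x <ᵇ shift q y ≡ x <ᵇ y
shift-<ᵇ q = mono⇒<ᵇ-invariant (shift q) (shift-mono q)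

shift-<ᵇ0 : ∀ {q} → 1 ≤ q → ∀ x → shift q x <ᵇ + 0 ≡ x <ᵇ + 0
shift-<ᵇ0 {q} 1≤q x = trans (cong (shift q x <ᵇ_) (sym (shift-zero 1≤q))) (shift-<ᵇ q x (+ 0))

∣shift∣-≢ : ∀ q x → ∣ shift q x ∣ ≢ q
∣shift∣-≢ q x with ℕ.<-≤-connex ∣ x ∣ q
... | inj₁ h rewrite shift-< x h = λ e → ℕ.<-irrefl e h
... | inj₂ h rewrite ∣shift∣-≥ x h = λ e → ℕ.<-irrefl (sym e) (s≤s h)

∣shift∣-below : ∀ {q m} → m < q → ∀ x → ∣ shift q x ∣ ≡ m ⇔ ∣ x ∣ ≡ m
∣shift∣-below {q} {m} m<q x with ℕ.<-≤-connex ∣ x ∣ q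
... | inj₁ h rewrite shift-< x h = mk⇔ (λ e → e) (λ e → e)
... | inj₂ h rewrite ∣shift∣-≥ x h =
  mk⇔ (λ e → ⊥-elim (ℕ.<-irrefl (sym e) (ℕ.<-≤-trans m<q (ℕ.m≤n⇒m≤1+n h))))
      (λ e → ⊥-elim (ℕ.<-irrefl (sym e) (ℕ.<-≤-trans m<q h)))

∣shift∣-above : ∀ {q m} → q ≤ m → ∀ x → ∣ shift q x ∣ ≡ suc m ⇔ ∣ x ∣ ≡ m
∣shift∣-above {q} {m} q≤m x with ℕ.<-≤-connex ∣ x ∣ q
... | inj₁ h rewrite shift-< x h =
  mk⇔ (λ e → ⊥-elim (ℕ.<-irrefl e (ℕ.<-≤-trans h (ℕ.m≤n⇒m≤1+n q≤m))))
      (λ e → ⊥-elim (ℕ.<-irrefl e (ℕ.<-≤-trans h q≤m)))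
... | inj₂ h rewrite ∣shift∣-≥ x h = mk⇔ ℕ.suc-injective (cong suc)

-- Descents

lastOr : ℤ → List ℤ → ℤ
lastOr p []      = p
lastOr p (x ∷ A) = lastOr x A

lastOr-All : ∀ {P : ℤ → Set} {p} A → P p → All P A → P (lastOr p A)
lastOr-All []      Pp []         = Pp
lastOr-All (x ∷ A) _  (Px ∷ PA) = lastOr-All A Px PA

desFrom-++ : ∀ p A Z → desFrom p (A ++ Z) ≡ desFrom p A + desFrom (lastOr p A) Z
desFrom-++ p []      Z = refl
desFrom-++ p (x ∷ A) Z rewrite desFrom-++ x A Z = sym (ℕ.+-assoc (bit (x <ᵇ p)) (desFrom x A) _)

desFrom-map : ∀ (f : ℤ → ℤ) → (∀ x y → f x <ᵇ f y ≡ x <ᵇ y) →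
  ∀ p A → desFrom (f p) (map f A) ≡ desFrom p A
desFrom-map f f-<ᵇ p []      = refl
desFrom-map f f-<ᵇ p (x ∷ A) rewrite desFrom-map f f-<ᵇ x A | f-<ᵇ x p = refl

desB-shift : ∀ {q} → 1 ≤ q → ∀ L → desB (map (shift q) L) ≡ desB L
desB-shift {q} 1≤q L = trans (cong (λ p → desFrom p (map (shift q) L)) (sym (shift-zero 1≤q)))
                             (desFrom-map (shift q) (shift-<ᵇ q) (+ 0) L)

Twins : ℤ → ℤ → ℤ → Set
Twins u u′ y = (y <ᵇ u ≡ y <ᵇ u′) × (u <ᵇ y ≡ u′ <ᵇ y)

twins-sym : ∀ {u u′ y} → Twins u u′ y → Twins u′ u y
twins-sym (e₁ , e₂) = sym e₁ , sym e₂

desFrom-twins : ∀ {u u′} p M → All (Twins u u′) M →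
  desFrom p (u ∷ u′ ∷ M) ≡ bit (u′ <ᵇ u) + desFrom p (u ∷ M)
desFrom-twins {u} {u′} p []      []            = x∙yz≈y∙xz (bit (u <ᵇ p)) (bit (u′ <ᵇ u)) 0
desFrom-twins {u} {u′} p (y ∷ M) ((e , _) ∷ _) rewrite e =
  x∙yz≈y∙xz (bit (u <ᵇ p)) (bit (u′ <ᵇ u)) (desFrom u′ (y ∷ M))

desFrom-twin-swap : ∀ {u u′} p M → Twins u u′ p → All (Twins u u′) M →
  desFrom p (u ∷ M) ≡ desFrom p (u′ ∷ M)
desFrom-twin-swap p []      (_ , e) []            rewrite e = refl
desFrom-twin-swap p (y ∷ M) (_ , e) ((e′ , _) ∷ _) rewrite e | e′ = refl

-- Neither neighbour of the pair tells u from u′, so the only new comparison is the one inside the pair.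
desB-twins : ∀ {u u′ w} B C → Twins u u′ (+ 0) → All (Twins u u′) B → All (Twins u u′) C →
  w ≡ u ⊎ w ≡ u′ → desB (B ++ u ∷ u′ ∷ C) ≡ bit (u′ <ᵇ u) + desB (B ++ w ∷ C)
desB-twins {u} {u′} {w} B C T0 TB TC w∈ = begin
  desFrom (+ 0) (B ++ u ∷ u′ ∷ C)      ≡⟨ desFrom-++ (+ 0) B _ ⟩
  d₀ + desFrom p (u ∷ u′ ∷ C)          ≡⟨ cong (d₀ ℕ.+_) (desFrom-twins p C TC) ⟩
  d₀ + (c + desFrom p (u ∷ C))         ≡⟨ x∙yz≈y∙xz d₀ c (desFrom p (u ∷ C)) ⟩
  c + (d₀ + desFrom p (u ∷ C))         ≡⟨ cong (λ d → c + (d₀ + d)) (u-as-w w∈) ⟩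
  c + (d₀ + desFrom p (w ∷ C))         ≡⟨ cong (c ℕ.+_) (desFrom-++ (+ 0) B _) ⟨
  c + desFrom (+ 0) (B ++ w ∷ C)       ∎
  where
  open ≡-Reasoning
  c : ℕ
  c = bit (u′ <ᵇ u)
  p : ℤ
  p = lastOr (+ 0) B
  d₀ : ℕ
  d₀ = desFrom (+ 0) B
  u-as-w : w ≡ u ⊎ w ≡ u′ → desFrom p (u ∷ C) ≡ desFrom p (w ∷ C)
  u-as-w (inj₁ w≡u)  = cong (λ z → desFrom p (z ∷ C)) (sym w≡u)
  u-as-w (inj₂ w≡u′) =
    trans (desFrom-twin-swap p C (lastOr-All B T0 TB) TC) (cong (λ z → desFrom p (z ∷ C)) (sym w≡u′))

-- Descents at the corners of a pivot square

Far : ℕ → ℤ → Set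
Far m y = ∣ y ∣ ≢ m × ∣ y ∣ ≢ suc m

far-twins : ∀ b j {y} → Far (suc j) y → Twins (signed b (suc j)) (signed b (suc (suc j))) y
far-twins false j {+ a}    (a≢ , a≢′) =
    isYes-⇔ (mk⇔ (λ { (ℤ.+<+ h) → ℤ.+<+ (ℕ.m<n⇒m<1+n h) })
                 (λ { (ℤ.+<+ h) → ℤ.+<+ (ℕ.≤∧≢⇒< (ℕ.≤-pred h) a≢) })) _ _
  , isYes-⇔ (mk⇔ (λ { (ℤ.+<+ h) → ℤ.+<+ (ℕ.≤∧≢⇒< h (a≢′ ∘ sym)) })
                 (λ { (ℤ.+<+ h) → ℤ.+<+ (ℕ.<-trans (ℕ.n<1+n (suc j)) h) })) _ _
far-twins false j { -[1+ a ]} _ = refl , refl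
far-twins true  j {+ a}    _ = refl , refl
far-twins true  j { -[1+ a ]} (a≢ , a≢′) =
    isYes-⇔ (mk⇔ (λ { (ℤ.-<- h) → ℤ.-<- (ℕ.≤∧≢⇒< h (a≢′ ∘ cong suc ∘ sym)) })
                 (λ { (ℤ.-<- h) → ℤ.-<- (ℕ.<-trans (ℕ.n<1+n j) h) })) _ _
  , isYes-⇔ (mk⇔ (λ { (ℤ.-<- h) → ℤ.-<- (ℕ.m<n⇒m<1+n h) })
                 (λ { (ℤ.-<- h) → ℤ.-<- (ℕ.≤∧≢⇒< (ℕ.≤-pred h) (a≢ ∘ cong suc)) })) _ _

far-shift : ∀ {m q} → m ≤ q → q ≤ suc m → ∀ {a} → ∣ a ∣ ≢ m → Far m (shift q a)
far-shift {m} {q} m≤q q≤sm {a} a≢m with ℕ.<-≤-connex ∣ a ∣ q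
... | inj₁ a<q rewrite shift-< a a<q =
  let a<m = ℕ.≤∧≢⇒< (ℕ.≤-pred (ℕ.≤-trans a<q q≤sm)) a≢m
  in (λ e → ℕ.<-irrefl e a<m) , (λ e → ℕ.<-irrefl e (ℕ.m<n⇒m<1+n a<m))
... | inj₂ q≤a rewrite ∣shift∣-≥ a q≤a =
  let m<a = ℕ.≤∧≢⇒< (ℕ.≤-trans m≤q q≤a) (a≢m ∘ sym)
  in (λ e → ℕ.<-irrefl (sym e) (ℕ.m<n⇒m<1+n m<a)) , (λ e → ℕ.<-irrefl (sym e) (s≤s m<a))

record Pivot (L : List ℤ) (i : ℕ) (x : ℤ) : Set where
  constructor pivot
  field
    prefix suffix  : List ℤ
    decomposition  : L ≡ prefix ++ x ∷ suffix
    position       : suc (length prefix) ≡ i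
    prefix-avoids  : All (λ a → ∣ a ∣ ≢ ∣ x ∣) prefix
    suffix-avoids  : All (λ a → ∣ a ∣ ≢ ∣ x ∣) suffix

insertAt-before : ∀ {q v x x′} A R → shift q x ≡ x′ →
  insertAt (suc (length A)) q v (A ++ x ∷ R) ≡ map (shift q) A ++ v ∷ x′ ∷ map (shift q) R
insertAt-before []      R refl = refl
insertAt-before {q} (a ∷ A) R tx≡ = cong (shift q a ∷_) (insertAt-before {q} A R tx≡)

insertAt-after : ∀ {q v x x′} A R → shift q x ≡ x′ →
  insertAt (suc (suc (length A))) q v (A ++ x ∷ R) ≡ map (shift q) A ++ x′ ∷ v ∷ map (shift q) R
insertAt-after []      R refl = refl
insertAt-after {q} (a ∷ A) R tx≡ = cong (shift q a ∷_) (insertAt-after {q} A R tx≡)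

desB-twin-insert : ∀ {q x u u′} A R → 1 ≤ q → Twins u u′ (+ 0) →
  All (Twins u u′) (map (shift q) A) → All (Twins u u′) (map (shift q) R) →
  shift q x ≡ u ⊎ shift q x ≡ u′ →
  desB (map (shift q) A ++ u ∷ u′ ∷ map (shift q) R) ≡ bit (u′ <ᵇ u) + desB (A ++ x ∷ R)
desB-twin-insert {q} {x} {u} {u′} A R 1≤q T0 TA TR tx∈ = begin
  desB (map t A ++ u ∷ u′ ∷ map t R)     ≡⟨ desB-twins (map t A) _ T0 TA TR tx∈ ⟩
  c + desB (map t A ++ map t (x ∷ R))    ≡⟨ cong (λ L → c + desB L) (List.map-++ t A (x ∷ R)) ⟨
  c + desB (map t (A ++ x ∷ R))          ≡⟨ cong (c ℕ.+_) (desB-shift 1≤q (A ++ x ∷ R)) ⟩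
  c + desB (A ++ x ∷ R)                  ∎
  where
  open ≡-Reasoning
  t : ℤ → ℤ
  t = shift q
  c : ℕ
  c = bit (u′ <ᵇ u)

-- Each lemma is named after the corner of the pivot's square at which the value is inserted;
-- grid point (i, j) is the top-left corner of the square ⟨i, j⟩.
module _ (b : Bool) (j : ℕ) where

  private
    s₁ s₂ : ℤ
    s₁ = signed b (suc j)
    s₂ = signed b (suc (suc j))

    Avoids : List ℤ → Set
    Avoids = All (λ a → ∣ a ∣ ≢ ∣ s₁ ∣)

    twins-shifted : ∀ {q} → suc j ≤ q → q ≤ suc (suc j) → ∀ {A} → Avoids A →
      All (Twins s₁ s₂) (map (shift q) A)
    twins-shifted j<q q≤ =
      All.map⁺ ∘ All.map (λ a≢ → far-twins b j (far-shift j<q q≤ (subst (_ ≢_) (∣signed∣ b (suc j)) a≢)))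

    twins-zero : Twins s₁ s₂ (+ 0)
    twins-zero = far-twins b j ((λ ()) , (λ ()))

    ascending : ∀ {q} A R → suc j ≤ q → q ≤ suc (suc j) → Avoids A → Avoids R →
      shift q s₁ ≡ s₁ ⊎ shift q s₁ ≡ s₂ →
      desB (map (shift q) A ++ s₁ ∷ s₂ ∷ map (shift q) R) ≡ bit b + desB (A ++ s₁ ∷ R)
    ascending {q} A R j<q q≤ avA avR tx∈ =
      trans (desB-twin-insert {q} A R (ℕ.≤-trans (s≤s z≤n) j<q) twins-zero
                              (twins-shifted j<q q≤ avA) (twins-shifted j<q q≤ avR) tx∈)
            (cong (λ c → bit c + desB (A ++ s₁ ∷ R)) (signed-suc-<ᵇ b j))

    descending : ∀ {q} A R → suc j ≤ q → q ≤ suc (suc j) → Avoids A → Avoids R →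
      shift q s₁ ≡ s₂ ⊎ shift q s₁ ≡ s₁ →
      desB (map (shift q) A ++ s₂ ∷ s₁ ∷ map (shift q) R) ≡ bit (not b) + desB (A ++ s₁ ∷ R)
    descending {q} A R j<q q≤ avA avR tx∈ =
      trans (desB-twin-insert {q} A R (ℕ.≤-trans (s≤s z≤n) j<q) (twins-sym twins-zero)
                              (All.map twins-sym (twins-shifted j<q q≤ avA))
                              (All.map twins-sym (twins-shifted j<q q≤ avR)) tx∈)
            (cong (λ c → bit c + desB (A ++ s₁ ∷ R)) (signed-<ᵇ-suc b j))

    shift-below : shift (suc j) s₁ ≡ s₂
    shift-below = shift-signed b (suc j) (s≤s z≤n) ℕ.≤-refl

    shift-above : shift (suc (suc j)) s₁ ≡ s₁
    shift-above = shift-signed-< b (suc j) ℕ.≤-refl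

  desB-topLeft : ∀ {L i} → Pivot L i s₁ → desB (insertAt i (suc j) s₁ L) ≡ bit b + desB L
  desB-topLeft (pivot A R refl refl avA avR) =
    trans (cong desB (insertAt-before {suc j} A R shift-below))
          (ascending {suc j} A R ℕ.≤-refl (ℕ.n≤1+n _) avA avR (inj₂ shift-below))

  desB-bottomRight : ∀ {L i} → Pivot L i s₁ → desB (insertAt (suc i) (suc (suc j)) s₂ L) ≡ bit b + desB L
  desB-bottomRight (pivot A R refl refl avA avR) =
    trans (cong desB (insertAt-after {suc (suc j)} A R shift-above))
          (ascending {suc (suc j)} A R (ℕ.n≤1+n _) ℕ.≤-refl avA avR (inj₁ shift-above))

  desB-topRight : ∀ {L i} → Pivot L i s₁ → desB (insertAt i (suc (suc j)) s₂ L) ≡ bit (not b) + desB L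
  desB-topRight (pivot A R refl refl avA avR) =
    trans (cong desB (insertAt-before {suc (suc j)} A R shift-above))
          (descending {suc (suc j)} A R (ℕ.n≤1+n _) ℕ.≤-refl avA avR (inj₂ shift-above))

  desB-bottomLeft : ∀ {L i} → Pivot L i s₁ → desB (insertAt (suc i) (suc j) s₁ L) ≡ bit (not b) + desB L
  desB-bottomLeft (pivot A R refl refl avA avR) =
    trans (cong desB (insertAt-after {suc j} A R shift-below))
          (descending {suc j} A R ℕ.≤-refl (ℕ.n≤1+n _) avA avR (inj₁ shift-below))

-- Signed positions and the inverse

signedPos-hit : ∀ {m c x} Y → ∣ x ∣ ≡ m → signedPos m c (x ∷ Y) ≡ signed (x <ᵇ + 0) c
signedPos-hit {m} {c} {x} Y e rewrite isYes-true (∣ x ∣ ℕ.≟ m) e = refl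

signedPos-skip : ∀ {m} c X Y → All (λ a → ∣ a ∣ ≢ m) X → signedPos m c (X ++ Y) ≡ signedPos m (c + length X) Y
signedPos-skip {m} c []      Y []          = cong (λ k → signedPos m k Y) (sym (ℕ.+-identityʳ c))
signedPos-skip {m} c (a ∷ X) Y (a≢ ∷ av) rewrite isYes-false (∣ a ∣ ℕ.≟ m) a≢ =
  trans (signedPos-skip (suc c) X Y av) (cong (λ k → signedPos m k Y) (sym (ℕ.+-suc c (length X))))

signedPos-suc : ∀ {m p} → 1 ≤ p → ∀ c Y → p ≤ c → signedPos m (suc c) Y ≡ shift p (signedPos m c Y)
signedPos-suc     1≤p c []      _   = sym (shift-zero 1≤p)
signedPos-suc {m} 1≤p c (y ∷ Y) p≤c with ⌊ ∣ y ∣ ℕ.≟ m ⌋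
... | true  = sym (shift-signed (y <ᵇ + 0) c 1≤p p≤c)
... | false = signedPos-suc 1≤p (suc c) Y (ℕ.m≤n⇒m≤1+n p≤c)

signedPos-delete : ∀ {m v} → ∣ v ∣ ≢ m → ∀ c → 1 ≤ c → ∀ X Y →
  signedPos m c (X ++ v ∷ Y) ≡ shift (c + length X) (signedPos m c (X ++ Y))
signedPos-delete {m} {v} v≢ c 1≤c [] Y rewrite isYes-false (∣ v ∣ ℕ.≟ m) v≢ | ℕ.+-identityʳ c =
  signedPos-suc 1≤c c Y ℕ.≤-refl
signedPos-delete {m} v≢ c 1≤c (x ∷ X) Y with ⌊ ∣ x ∣ ℕ.≟ m ⌋
... | true  = sym (shift-signed-< (x <ᵇ + 0) c (ℕ.m<m+n c (s≤s z≤n)))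
... | false = trans (signedPos-delete v≢ (suc c) (ℕ.m≤n⇒m≤1+n 1≤c) X Y)
                    (cong (λ k → shift k (signedPos m (suc c) (X ++ Y))) (sym (ℕ.+-suc c (length X))))

signedPos-map : ∀ {m m′} (f : ℤ → ℤ) → (∀ y → ∣ f y ∣ ≡ m ⇔ ∣ y ∣ ≡ m′) →
  (∀ y → f y <ᵇ + 0 ≡ y <ᵇ + 0) → ∀ c Y → signedPos m c (map f Y) ≡ signedPos m′ c Y
signedPos-map             f match sign c []      = refl
signedPos-map {m} {m′} f match sign c (y ∷ Y)
  rewrite isYes-⇔ (match y) (∣ f y ∣ ℕ.≟ m) (∣ y ∣ ℕ.≟ m′) | sign y
        | signedPos-map f match sign (suc c) Y = refl

signedPos-bound : ∀ m c Y → ∣ signedPos m c Y ∣ ≡ 0 ⊎ c ≤ ∣ signedPos m c Y ∣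
signedPos-bound m c []      = inj₁ refl
signedPos-bound m c (y ∷ Y) with ⌊ ∣ y ∣ ℕ.≟ m ⌋
... | true  = inj₂ (ℕ.≤-reflexive (sym (∣signed∣ (y <ᵇ + 0) c)))
... | false with signedPos-bound m (suc c) Y
...   | inj₁ is0 = inj₁ is0
...   | inj₂ c<   = inj₂ (ℕ.≤-trans (ℕ.n≤1+n c) c<)

signedPos-miss : ∀ {m x} → ∣ x ∣ ≢ m → ∀ c → 1 ≤ c → ∀ X Y →
  ∣ signedPos m c (X ++ x ∷ Y) ∣ ≢ c + length X
signedPos-miss {m} {x} x≢ c 1≤c [] Y rewrite isYes-false (∣ x ∣ ℕ.≟ m) x≢ | ℕ.+-identityʳ c
  with signedPos-bound m (suc c) Y
... | inj₁ is0 = λ e → ℕ.<-irrefl (trans (sym is0) e) 1≤c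
... | inj₂ c<   = λ e → ℕ.<-irrefl (sym e) c<
signedPos-miss {m} x≢ c 1≤c (a ∷ X) Y with ⌊ ∣ a ∣ ℕ.≟ m ⌋
... | true  = λ e → ℕ.<-irrefl (trans (sym (∣signed∣ (a <ᵇ + 0) c)) e) (ℕ.m<m+n c (s≤s z≤n))
... | false = λ e → signedPos-miss x≢ (suc c) (ℕ.m≤n⇒m≤1+n 1≤c) X Y (trans e (ℕ.+-suc c (length X)))

applyUpTo-cong : ∀ {A : Set} {f g : ℕ → A} → (∀ k → f k ≡ g k) → ∀ n → applyUpTo f n ≡ applyUpTo g n
applyUpTo-cong f≗g zero    = refl
applyUpTo-cong f≗g (suc n) = cong₂ _∷_ (f≗g 0) (applyUpTo-cong (f≗g ∘ suc) n)

applyUpTo-++ : ∀ {A : Set} (f : ℕ → A) m n → applyUpTo f (m + n) ≡ applyUpTo f m ++ applyUpTo (λ k → f (m + k)) n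
applyUpTo-++ f zero    n = refl
applyUpTo-++ f (suc m) n = cong (f 0 ∷_) (applyUpTo-++ (f ∘ suc) m n)

applyUpTo-insertAt : ∀ {t w} (F G : ℕ → ℤ) q n → q ≤ n →
  (∀ {k} → k < q → F k ≡ shift t (G k)) → F q ≡ w → (∀ k → q ≤ k → F (suc k) ≡ shift t (G k)) →
  applyUpTo F (suc n) ≡ insertAt (suc q) t w (applyUpTo G n)
applyUpTo-insertAt {t} F G zero n _ _ Fq≡w above =
  cong₂ _∷_ Fq≡w (trans (applyUpTo-cong (λ k → above k z≤n) n) (sym (List.map-applyUpTo G (shift t) n)))
applyUpTo-insertAt {t} F G (suc q) (suc n) (s≤s q≤n) below Fq≡w above =
  cong₂ _∷_ (below (s≤s z≤n))
            (applyUpTo-insertAt {t} (F ∘ suc) (G ∘ suc) q n q≤n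
                                (λ k<q → below (s≤s k<q)) Fq≡w (λ k q≤k → above (suc k) (s≤s q≤k)))

length-insertAt : ∀ i t v L → length (insertAt (suc i) t v L) ≡ suc (length L)
length-insertAt zero    t v L       = cong suc (List.length-map (shift t) L)
length-insertAt (suc i) t v []      = refl
length-insertAt (suc i) t v (x ∷ L) = cong suc (length-insertAt i t v L)

inverse-applyUpTo : ∀ L → inverse L ≡ applyUpTo (λ m → signedPos (suc m) 1 L) (length L)
inverse-applyUpTo L = List.map-upTo (λ m → signedPos (suc m) 1 L) (length L)

inverse-insertAt : ∀ b {p q} L → p ≤ length L → q ≤ length L →
  inverse (insertAt (suc p) (suc q) (signed b (suc q)) L) ≡ insertAt (suc q) (suc p) (signed b (suc p)) (inverse L)
inverse-insertAt b {p} {q} L p≤ q≤ = begin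
  inverse σ                                            ≡⟨ inverse-applyUpTo σ ⟩
  applyUpTo F (length σ)                               ≡⟨ cong (applyUpTo F) (length-insertAt p (suc q) v L) ⟩
  applyUpTo F (suc (length L))                         ≡⟨ applyUpTo-insertAt {suc p} F G q (length L) q≤ below at-q above ⟩
  insertAt (suc q) (suc p) w (applyUpTo G (length L))  ≡⟨ cong (insertAt (suc q) (suc p) w) (inverse-applyUpTo L) ⟨
  insertAt (suc q) (suc p) w (inverse L)               ∎
  where
  open ≡-Reasoning
  v w : ℤ
  v = signed b (suc q)
  w = signed b (suc p)
  t : ℤ → ℤ
  t = shift (suc q)
  A B σ : List ℤ
  A = take p L
  B = drop p L
  σ = insertAt (suc p) (suc q) v L
  F G : ℕ → ℤ
  F m = signedPos (suc m) 1 σ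
  G m = signedPos (suc m) 1 L

  ∣tA∣≡p : length (map t A) ≡ p
  ∣tA∣≡p = trans (List.length-map t A) (trans (List.length-take p L) (ℕ.m≤n⇒m⊓n≡m p≤))

  moved : ∀ {m m′} → (∀ y → ∣ t y ∣ ≡ m ⇔ ∣ y ∣ ≡ m′) → suc q ≢ m →
    signedPos m 1 σ ≡ shift (suc p) (signedPos m′ 1 L)
  moved {m} {m′} match q≢m = begin
    signedPos m 1 (map t A ++ v ∷ map t B)
      ≡⟨ signedPos-delete v≢m 1 ℕ.≤-refl (map t A) (map t B) ⟩
    shift (suc (length (map t A))) (signedPos m 1 (map t A ++ map t B))
      ≡⟨ cong₂ (λ k Z → shift (suc k) (signedPos m 1 Z)) ∣tA∣≡p (sym (List.map-++ t A B)) ⟩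
    shift (suc p) (signedPos m 1 (map t (A ++ B)))
      ≡⟨ cong (shift (suc p)) (signedPos-map t match (shift-<ᵇ0 (s≤s z≤n)) 1 (A ++ B)) ⟩
    shift (suc p) (signedPos m′ 1 (A ++ B))
      ≡⟨ cong (λ Z → shift (suc p) (signedPos m′ 1 Z)) (List.take++drop≡id p L) ⟩
    shift (suc p) (signedPos m′ 1 L)
      ∎
    where
    v≢m : ∣ v ∣ ≢ m
    v≢m e = q≢m (trans (sym (∣signed∣ b (suc q))) e)

  below : ∀ {k} → k < q → F k ≡ shift (suc p) (G k)
  below k<q = moved (∣shift∣-below (s≤s k<q)) (λ e → ℕ.<-irrefl (sym e) (s≤s k<q))

  above : ∀ k → q ≤ k → F (suc k) ≡ shift (suc p) (G k)
  above k q≤k = moved (∣shift∣-above (s≤s q≤k)) (λ e → ℕ.<-irrefl refl (subst (_≤ k) (ℕ.suc-injective e) q≤k))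

  at-q : F q ≡ w
  at-q = begin
    signedPos (suc q) 1 (map t A ++ v ∷ map t B)
      ≡⟨ signedPos-skip 1 (map t A) _ (All.map⁺ (All.universal (∣shift∣-≢ (suc q)) A)) ⟩
    signedPos (suc q) (suc (length (map t A))) (v ∷ map t B)
      ≡⟨ signedPos-hit {c = suc (length (map t A))} (map t B) (∣signed∣ b (suc q)) ⟩
    signed (v <ᵇ + 0) (suc (length (map t A)))
      ≡⟨ cong₂ signed (signed-suc-<ᵇ0 b q) (cong suc ∣tA∣≡p) ⟩
    w
      ∎

inverse-pivot : ∀ b {L i j} → Pivot L (suc i) (signed b (suc j)) → suc j ≤ length L →
  Pivot (inverse L) (suc j) (signed b (suc i))
inverse-pivot b {j = j} (pivot A R refl refl avA avR) j<∣L∣ =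
  pivot before after decomposition (cong suc (List.length-applyUpTo G j))
        (All.applyUpTo⁺₁ G j (λ k<j → avoids (ℕ.<⇒≢ k<j)))
        (All.applyUpTo⁺₁ (λ k → G (j + suc k)) r (λ _ → avoids (ℕ.m+1+n≢m j)))
  where
  open ≡-Reasoning
  x y : ℤ
  x = signed b (suc j)
  y = signed b (suc (length A))
  L : List ℤ
  L = A ++ x ∷ R
  G : ℕ → ℤ
  G m = signedPos (suc m) 1 L
  r : ℕ
  r = length L ℕ.∸ suc j

  ∣L∣≡ : length L ≡ j + suc r
  ∣L∣≡ = trans (sym (ℕ.m+[n∸m]≡n j<∣L∣)) (sym (ℕ.+-suc j r))

  G-pivot : G (j + 0) ≡ y
  G-pivot = begin
    G (j + 0)
      ≡⟨ cong G (ℕ.+-identityʳ j) ⟩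
    signedPos (suc j) 1 (A ++ x ∷ R)
      ≡⟨ signedPos-skip 1 A (x ∷ R) (All.map (subst (_ ≢_) (∣signed∣ b (suc j))) avA) ⟩
    signedPos (suc j) (suc (length A)) (x ∷ R)
      ≡⟨ signedPos-hit {c = suc (length A)} R (∣signed∣ b (suc j)) ⟩
    signed (x <ᵇ + 0) (suc (length A))
      ≡⟨ cong (λ c → signed c (suc (length A))) (signed-suc-<ᵇ0 b j) ⟩
    y
      ∎

  before after : List ℤ
  before = applyUpTo G j
  after  = applyUpTo (λ k → G (j + suc k)) r

  decomposition : inverse L ≡ before ++ y ∷ after
  decomposition = begin
    inverse L                        ≡⟨ inverse-applyUpTo L ⟩
    applyUpTo G (length L)           ≡⟨ cong (applyUpTo G) ∣L∣≡ ⟩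
    applyUpTo G (j + suc r)          ≡⟨ applyUpTo-++ G j (suc r) ⟩
    before ++ G (j + 0) ∷ after      ≡⟨ cong (λ z → before ++ z ∷ after) G-pivot ⟩
    before ++ y ∷ after              ∎

  avoids : ∀ {k} → k ≢ j → ∣ G k ∣ ≢ ∣ y ∣
  avoids {k} k≢j e = signedPos-miss x≢ 1 ℕ.≤-refl A R (trans e (∣signed∣ b (suc (length A))))
    where
    x≢ : ∣ x ∣ ≢ suc k
    x≢ e′ = k≢j (ℕ.suc-injective (trans (sym e′) (∣signed∣ b (suc j))))

diff-+ : ∀ c a → diff (c + a) a ≡ + c
diff-+ c a = trans (ℤ.[+m]-[+n]≡m⊖n (c + a) a) (trans (ℤ.⊖-≥ (ℕ.m≤n+m a c)) (cong +_ (ℕ.m+n∸n≡m c a)))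

dPair-≡ : ∀ c {σ L} → desB σ ≡ c + desB L → idesB σ ≡ c + idesB L → dPair σ L ≡ (+ c , + c)
dPair-≡ c {σ} {L} des ides = cong₂ _,_ (trans (cong (λ d → diff d (desB L)) des) (diff-+ c (desB L)))
                                       (trans (cong (λ d → diff d (idesB L)) ides) (diff-+ c (idesB L)))

-- insertAt i j (signed false j) is φ_{(i,j)} and insertAt i j (signed true j) is φ̄_{(i,j)}.
CornerValues : Bool → List ℤ → ℕ → ℕ → Set
CornerValues b L i j =
  dPair (insertAt i j (signed b j) L) L ≡ (+ bit b , + bit b) ×
  dPair (insertAt (suc i) (suc j) (signed b (suc j)) L) L ≡ (+ bit b , + bit b) ×
  dPair (insertAt i (suc j) (signed b (suc j)) L) L ≡ (+ bit (not b) , + bit (not b)) ×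
  dPair (insertAt (suc i) j (signed b j) L) L ≡ (+ bit (not b) , + bit (not b))

dPair-insertAt : ∀ b c p q L → p ≤ length L → q ≤ length L →
  desB (insertAt (suc p) (suc q) (signed b (suc q)) L) ≡ c + desB L →
  desB (insertAt (suc q) (suc p) (signed b (suc p)) (inverse L)) ≡ c + desB (inverse L) →
  dPair (insertAt (suc p) (suc q) (signed b (suc q)) L) L ≡ (+ c , + c)
dPair-insertAt b c p q L p≤ q≤ des des⁻¹ =
  dPair-≡ c {insertAt (suc p) (suc q) (signed b (suc q)) L} {L} des (trans (cong desB (inverse-insertAt b L p≤ q≤)) des⁻¹)

cornerValues : ∀ b {L i j} → Pivot L (suc i) (signed b (suc j)) → suc i ≤ length L → suc j ≤ length L →
  CornerValues b L (suc i) (suc j)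
cornerValues b {L} {i} {j} P i<∣L∣ j<∣L∣ =
    dPair-insertAt b (bit b)       i       j       L i≤∣L∣ j≤∣L∣ (desB-topLeft b j P)     (desB-topLeft b i P⁻¹)
  , dPair-insertAt b (bit b)       (suc i) (suc j) L i<∣L∣ j<∣L∣ (desB-bottomRight b j P) (desB-bottomRight b i P⁻¹)
  , dPair-insertAt b (bit (not b)) i       (suc j) L i≤∣L∣ j<∣L∣ (desB-topRight b j P)    (desB-bottomLeft b i P⁻¹)
  , dPair-insertAt b (bit (not b)) (suc i) j       L i<∣L∣ j≤∣L∣ (desB-bottomLeft b j P)  (desB-topRight b i P⁻¹)
  where
  P⁻¹ : Pivot (inverse L) (suc j) (signed b (suc i))
  P⁻¹ = inverse-pivot b P j<∣L∣
  i≤∣L∣ : i ≤ length L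
  i≤∣L∣ = ℕ.<⇒≤ i<∣L∣
  j≤∣L∣ : j ≤ length L
  j≤∣L∣ = ℕ.<⇒≤ j<∣L∣

signedPerm-length : ∀ {n π} → IsSignedPerm n π → length π ≡ n
signedPerm-length {n} {π} perm =
  trans (sym (List.length-map ∣_∣ π)) (trans (↭-length perm) (trans (List.length-map suc (upTo n)) (List.length-upTo n)))

signedPerm-∣∣-unique : ∀ {n π} → IsSignedPerm n π → AllPairs (λ a b → ∣ a ∣ ≢ ∣ b ∣) π
signedPerm-∣∣-unique {n} perm =
  AllPairs.map⁻ (Unique-resp-↭ (↭⇒↭ₛ (↭-sym perm)) (Unique.map⁺ ℕ.suc-injective (Unique.upTo⁺ n)))

entry-pivot : ∀ {L x} → AllPairs (λ a b → ∣ a ∣ ≢ ∣ b ∣) L → x ≢ + 0 → ∀ k → entry L (suc k) ≡ x →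
  Pivot L (suc k) x
entry-pivot {[]}    _              x≢0 k       e    = ⊥-elim (x≢0 (sym e))
entry-pivot {y ∷ L} (y≢ ∷ _)       _   zero    refl = pivot [] L refl refl [] (All.map (_∘ sym) y≢)
entry-pivot {y ∷ L} (y≢ ∷ unique)  x≢0 (suc k) e    with entry-pivot unique x≢0 k e
... | pivot A R refl refl avA avR = pivot (y ∷ A) R refl refl (All.head (All.++⁻ʳ A y≢) ∷ avA) avR

proposition3p7 : (n : ℕ) (π : List ℤ) → IsSignedPerm n π →
    (i j : ℕ) → 1 ≤ i → i ≤ n → 1 ≤ j → j ≤ n →
    (entry π i ≡ + j →
      d⁺ π i j ≡ (+ 0 , + 0) × d⁺ π (suc i) (suc j) ≡ (+ 0 , + 0) ×
      d⁺ π i (suc j) ≡ (+ 1 , + 1) × d⁺ π (suc i) j ≡ (+ 1 , + 1)) ×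
    (entry π i ≡ - (+ j) →
      d⁻ π i j ≡ (+ 1 , + 1) × d⁻ π (suc i) (suc j) ≡ (+ 1 , + 1) ×
      d⁻ π i (suc j) ≡ (+ 0 , + 0) × d⁻ π (suc i) j ≡ (+ 0 , + 0))
proposition3p7 n π perm zero    j       () _   _  _
proposition3p7 n π perm (suc i) zero    _  _   () _
proposition3p7 n π perm (suc i) (suc j) _  i≤n _  j≤n = corners false , corners true
  where
  bound : ∀ {k} → k ≤ n → k ≤ length π
  bound = subst (_ ≤_) (sym (signedPerm-length perm))
  corners : ∀ b → entry π (suc i) ≡ signed b (suc j) → CornerValues b π (suc i) (suc j)
  corners b e =
    cornerValues b (entry-pivot (signedPerm-∣∣-unique perm) (signed-suc-≢0 b j) i e) (bound i≤n) (bound j≤n)
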